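{- Let $k\ge 6$ and let $H'$ be the graph with vertices $c,d,e,f_1,\dots,f_{k-3},g,h,i$ and edges $cd,de,hg,gi$ and $gf_j,df_j$ for $j=1,\dots,k-3$. Then $H'$ is planar, and for integers $x,y$ there exists a $k$-$L(2,1)$-labelling $L$ of $H'$ with $L(c)=x$ and $L(d)=y$ if and only if $(x,y)\in\{(0,k),(1,k),(k-1,0),(k,0)\}$.
   Context: A $k$-$L(2,1)$-labelling (an $L(2,1)$-labelling with span $k$) of a graph is a map $L$ from its vertices to $\{0,\dots,k\}$ such that adjacent vertices get labels differing by at least $2$ and vertices at distance $2$ get distinct labels. -}

module Defs where

open import Data.Nat using (ℕ; _≤_; _∸_; ∣_-_∣)
open import Data.Fin using (Fin)
open import Data.Product using (_×_; _,_; ∃; ∃-syntax; proj₁; proj₂)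
open import Data.Sum using (_⊎_)
open import Data.Rational using (ℚ; 0ℚ; 1ℚ) renaming (_+_ to _+ℚ_; _*_ to _*ℚ_; _-_ to _-ℚ_; _≤_ to _≤ℚ_)
open import Relation.Binary.PropositionalEquality using (_≡_; _≢_)
open import Relation.Nullary using (¬_)
open import Function.Definitions using (Injective)

record Graph : Set₁ where
  field
    V   : Set
    Adj : V → V → Set
    sym : ∀ {u v} → Adj u v → Adj v u
    irr : ∀ {u} → ¬ Adj u u
open Graph public

Dist2 : (G : Graph) → V G → V G → Set
Dist2 G u v = u ≢ v × ¬ Adj G u v × ∃[ w ] (Adj G u w × Adj G w v)

IsL21 : (k : ℕ) (G : Graph) → (V G → ℕ) → Set
IsL21 k G L =
  (∀ v → L v ≤ k) ×
  (∀ u v → Adj G u v → 2 ≤ ∣ L u - L v ∣) ×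
  (∀ u v → Dist2 G u v → L u ≢ L v)

-- Planarity: existence of a straight-line crossing-free drawing in ℚ²
-- (equivalent to planarity by Fáry's theorem)

Point : Set
Point = ℚ × ℚ

OnSeg : Point → Point → Point → Set
OnSeg p a b = ∃[ t ] (0ℚ ≤ℚ t × t ≤ℚ 1ℚ ×
  p ≡ (proj₁ a +ℚ t *ℚ (proj₁ b -ℚ proj₁ a) , proj₂ a +ℚ t *ℚ (proj₂ b -ℚ proj₂ a)))

SameEdge : {X : Set} → X → X → X → X → Set
SameEdge u v w z = (u ≡ w × v ≡ z) ⊎ (u ≡ z × v ≡ w)

StraightLineDrawing : (G : Graph) → (V G → Point) → Set
StraightLineDrawing G pos =
  Injective _≡_ _≡_ pos ×
  (∀ w u v → Adj G u v → w ≢ u → w ≢ v → ¬ OnSeg (pos w) (pos u) (pos v)) ×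
  (∀ u v w z → Adj G u v → Adj G w z → ¬ SameEdge u v w z →
     ∀ p → OnSeg p (pos u) (pos v) → OnSeg p (pos w) (pos z) →
     (p ≡ pos u ⊎ p ≡ pos v) × (p ≡ pos w ⊎ p ≡ pos z))

Planar : Graph → Set
Planar G = ∃[ pos ] StraightLineDrawing G pos

data VH (k : ℕ) : Set where
  c d e g h i : VH k
  f : Fin (k ∸ 3) → VH k

data EH (k : ℕ) : VH k → VH k → Set where
  cd : EH k c d
  de : EH k d e
  hg : EH k h g
  gi : EH k g i
  gf : (j : Fin (k ∸ 3)) → EH k g (f j)
  df : (j : Fin (k ∸ 3)) → EH k d (f j)

AdjH : (k : ℕ) → VH k → VH k → Set
AdjH k u v = EH k u v ⊎ EH k v u

private
  irrE : ∀ {k u} → ¬ EH k u u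
  irrE ()

  irrH : ∀ {k u} → ¬ AdjH k u u
  irrH (Data.Sum.inj₁ x) = irrE x
  irrH (Data.Sum.inj₂ x) = irrE x

  symH : ∀ {k u v} → AdjH k u v → AdjH k v u
  symH (Data.Sum.inj₁ x) = Data.Sum.inj₂ x
  symH (Data.Sum.inj₂ x) = Data.Sum.inj₁ x

H' : ℕ → Graph
H' k = record { V = VH k ; Adj = AdjH k ; sym = symH ; irr = irrH }

module Submission where

-- Each of d and g has k − 1 neighbours; by the distance-2 condition their labels are
-- pairwise distinct, and they avoid the three values around the label of the centre. Only k + 1
-- labels exist, so a centre with an interior label leaves room for just k − 2 of them: hence
-- L(d), L(g) ∈ {0, k}, and L(d) ≠ L(g) because d and g share the neighbour f₁. If L(d) = k, then
-- L(g) = 0, so c and the f_j are k − 2 distinct labels in [0, k − 2], the f_j even in [2, k − 2],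
-- which has only k − 3 values; thus L(c) ≤ 1. The case L(d) = 0 is the mirror image under L ↦ k − L.
-- Conversely c, e ↦ b, 1 − b, d ↦ k, g ↦ 0, h ↦ k − 1, i ↦ k, f_j ↦ j + 1 (b ∈ {0, 1}) and its
-- mirror image realise the four pairs.
--
-- Put the vertices on the horizontal lines y = 0, …, 4 so that every edge joins two
-- consecutive lines and, within each band between consecutive lines, all edges share one vertex.
-- Segments in different bands can only meet on a common line, i.e. at endpoints; segments in the
-- same band form a fan and meet only at its apex.

open import Defs hiding (sym)

module Labelling where

  open import Data.Nat using (ℕ; zero; suc; _+_; _∸_; _≤_; _<_; z≤n; s≤s; s≤s⁻¹; ∣_-_∣)
  open import Data.Nat.Properties
  open import Data.Fin as Fin using (Fin; toℕ)
  open import Data.Fin.Properties using (injective⇒≤; fromℕ<-injective; toℕ<n; toℕ-injective)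
  open import Data.Vec.Functional using (_∷_)
  open import Data.Product using (_×_; _,_; ∃-syntax; proj₁; proj₂)
  open import Data.Sum as Sum using (_⊎_; inj₁; inj₂)
  open import Data.Empty using (⊥-elim)
  open import Function using (_∘_)
  open import Function.Definitions using (Injective)
  open import Relation.Binary.PropositionalEquality
  open import Relation.Nullary using (¬_; yes; no)

  2+m≤n⇒2≤∣m-n∣ : ∀ {m n} → 2 + m ≤ n → 2 ≤ ∣ m - n ∣
  2+m≤n⇒2≤∣m-n∣ 2+m≤n = subst (2 ≤_) (sym (m≤n⇒∣m-n∣≡n∸m (m+n≤o⇒n≤o 2 2+m≤n)))
                                         (m+n≤o⇒m≤o∸n 2 2+m≤n)

  2≤∣m-n∣⇒2+m≤n : ∀ {m n} → m ≤ n → 2 ≤ ∣ m - n ∣ → 2 + m ≤ n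
  2≤∣m-n∣⇒2+m≤n m≤n 2≤∣m-n∣ = m≤o∸n⇒m+n≤o 2 m≤n (subst (2 ≤_) (m≤n⇒∣m-n∣≡n∸m m≤n) 2≤∣m-n∣)

  2≤∣m-n∣⇒2+m≤n⊎2+n≤m : ∀ m n → 2 ≤ ∣ m - n ∣ → 2 + m ≤ n ⊎ 2 + n ≤ m
  2≤∣m-n∣⇒2+m≤n⊎2+n≤m m n 2≤∣m-n∣ with ≤-total m n
  ... | inj₁ m≤n = inj₁ (2≤∣m-n∣⇒2+m≤n m≤n 2≤∣m-n∣)
  ... | inj₂ n≤m = inj₂ (2≤∣m-n∣⇒2+m≤n n≤m (subst (2 ≤_) (∣-∣-comm m n) 2≤∣m-n∣))

  ∣k-k∸n∣≡n : ∀ {k n} → n ≤ k → ∣ k - k ∸ n ∣ ≡ n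
  ∣k-k∸n∣≡n {k} {n} n≤k = trans (m≤n⇒∣n-m∣≡n∸m (m∸n≤m k n)) (m∸[m∸n]≡n n≤k)

  ∣k∸m-k∸n∣≡∣m-n∣ : ∀ {k m n} → m ≤ k → n ≤ k → ∣ k ∸ m - k ∸ n ∣ ≡ ∣ m - n ∣
  ∣k∸m-k∸n∣≡∣m-n∣         z≤n       n≤k       = ∣k-k∸n∣≡n n≤k
  ∣k∸m-k∸n∣≡∣m-n∣ {k} {m} m≤k       z≤n       =
    trans (∣-∣-comm (k ∸ m) k) (trans (∣k-k∸n∣≡n m≤k) (sym (∣-∣-identityʳ m)))
  ∣k∸m-k∸n∣≡∣m-n∣         (s≤s m≤k) (s≤s n≤k) = ∣k∸m-k∸n∣≡∣m-n∣ m≤k n≤k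

  ≤1⇒≡0⊎≡1 : ∀ {m} → m ≤ 1 → m ≡ 0 ⊎ m ≡ 1
  ≤1⇒≡0⊎≡1 z≤n       = inj₁ refl
  ≤1⇒≡0⊎≡1 (s≤s z≤n) = inj₂ refl

  ≤1⇒≢1∸ : ∀ {m} → m ≤ 1 → m ≢ 1 ∸ m
  ≤1⇒≢1∸ z≤n       ()
  ≤1⇒≢1∸ (s≤s z≤n) ()

  ≤1⇒≢2+ : ∀ {m x} → m ≤ 1 → m ≢ 2 + x
  ≤1⇒≢2+ (s≤s ()) refl

  bounded-injective⇒≤ : ∀ {m n} (φ : Fin m → ℕ) → (∀ a → φ a < n) → Injective _≡_ _≡_ φ → m ≤ n
  bounded-injective⇒≤ φ φ<n φ-injective =
    injective⇒≤ (λ {a} {b} → φ-injective ∘ fromℕ<-injective (φ a) (φ b) (φ<n a) (φ<n b))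

  injective-into-interval⇒≤ : ∀ {m n} o (φ : Fin m → ℕ) → (∀ a → o ≤ φ a) → (∀ a → φ a ≤ o + n) →
                              Injective _≡_ _≡_ φ → m ≤ suc n
  injective-into-interval⇒≤ {n = n} o φ o≤φ φ≤o+n φ-injective =
    bounded-injective⇒≤ (λ a → φ a ∸ o)
      (λ a → s≤s (subst (φ a ∸ o ≤_) (m+n∸m≡n o n) (∸-monoˡ-≤ o (φ≤o+n a))))
      (λ {a} {b} → φ-injective ∘ ∸-cancelʳ-≡ (o≤φ a) (o≤φ b))

  -- squeeze closes the gap {y, 1 + y, 2 + y} between the two sides of an Outside value.
  module _ {y : ℕ} where

    Outside : ℕ → Set
    Outside ℓ = 2 + ℓ ≤ suc y ⊎ 2 + suc y ≤ ℓ

    squeeze : ∀ ℓ → Outside ℓ → ℕ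
    squeeze ℓ (inj₁ _) = ℓ
    squeeze ℓ (inj₂ _) = ℓ ∸ 3

    below<above∸3 : ∀ {ℓ ℓ′} → 2 + ℓ ≤ suc y → 2 + suc y ≤ ℓ′ → ℓ < ℓ′ ∸ 3
    below<above∸3 (s≤s ℓ<y) (s≤s (s≤s (s≤s y≤ℓ′∸3))) = ≤-trans ℓ<y y≤ℓ′∸3

    squeeze-injective : ∀ {ℓ ℓ′} (o : Outside ℓ) (o′ : Outside ℓ′) → squeeze ℓ o ≡ squeeze ℓ′ o′ → ℓ ≡ ℓ′
    squeeze-injective (inj₁ _) (inj₁ _) eq = eq
    squeeze-injective (inj₂ o) (inj₂ o′) eq = ∸-cancelʳ-≡ (m+n≤o⇒m≤o 3 o) (m+n≤o⇒m≤o 3 o′) eq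
    squeeze-injective (inj₁ o) (inj₂ o′) eq = ⊥-elim (<-irrefl eq (below<above∸3 o o′))
    squeeze-injective (inj₂ o) (inj₁ o′) eq = ⊥-elim (<-irrefl (sym eq) (below<above∸3 o′ o))

    squeeze-< : ∀ {n ℓ} → ℓ ≤ 2 + n → y ≤ n → (o : Outside ℓ) → squeeze ℓ o < n
    squeeze-< _                 y≤n (inj₁ (s≤s ℓ<y))         = ≤-trans ℓ<y y≤n
    squeeze-< (s≤s (s≤s ℓ∸3<n)) _   (inj₂ (s≤s (s≤s (s≤s _)))) = ℓ∸3<n

  injective-outside-window⇒≤ : ∀ {m n y} (φ : Fin m → ℕ) → (∀ a → φ a ≤ 2 + n) →
                               (∀ a → 2 ≤ ∣ φ a - suc y ∣) → y ≤ n → Injective _≡_ _≡_ φ → m ≤ n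
  injective-outside-window⇒≤ {y = y} φ φ≤2+n far y≤n φ-injective =
    bounded-injective⇒≤ (λ a → squeeze (φ a) (side a)) (λ a → squeeze-< (φ≤2+n a) y≤n (side a))
      (λ {a} {b} → φ-injective ∘ squeeze-injective (side a) (side b))
    where
    side : ∀ a → Outside {y} (φ a)
    side a = 2≤∣m-n∣⇒2+m≤n⊎2+n≤m (φ a) (suc y) (far a)

  injective-far⇒extreme : ∀ {m k y} (φ : Fin m → ℕ) → (∀ a → φ a ≤ k) → (∀ a → 2 ≤ ∣ φ a - y ∣) →
                          Injective _≡_ _≡_ φ → y ≤ k → k ≤ suc m → y ≡ 0 ⊎ y ≡ k
  injective-far⇒extreme {y = zero} _ _ _ _ _ _ = inj₁ refl
  injective-far⇒extreme {y = suc y} φ φ≤k far φ-injective (s≤s y≤k) k≤1+m with m≤n⇒m<n∨m≡n y≤k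
  ... | inj₂ refl      = inj₂ refl
  ... | inj₁ (s≤s y≤n) =
    ⊥-elim (≤⇒≯ (injective-outside-window⇒≤ φ φ≤k far y≤n φ-injective) (s≤s⁻¹ k≤1+m))

  module IsL21-Properties {k : ℕ} {G : Graph} {L : V G → ℕ} (isL : IsL21 k G L) where

    label-≤ : ∀ v → L v ≤ k
    label-≤ = proj₁ isL

    adjacent-labels-far : ∀ {u v} → Adj G u v → 2 ≤ ∣ L u - L v ∣
    adjacent-labels-far = proj₁ (proj₂ isL) _ _

    common-neighbour⇒labels-distinct : ∀ {u v w} → Adj G u w → Adj G v w → u ≢ v → L u ≢ L v
    common-neighbour⇒labels-distinct {u} {v} {w} uw vw u≢v Lu≡Lv =
      proj₂ (proj₂ isL) u v (u≢v , ¬uv , w , uw , Graph.sym G vw) Lu≡Lv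
      where
      ¬uv : ¬ Adj G u v
      ¬uv uv with () ← subst (2 ≤_) (m≡n⇒∣m-n∣≡0 Lu≡Lv) (adjacent-labels-far uv)

    neighbour-labels-injective : ∀ {m v} (nbr : Fin m → V G) → Injective _≡_ _≡_ nbr →
                                 (∀ a → Adj G (nbr a) v) → Injective _≡_ _≡_ (L ∘ nbr)
    neighbour-labels-injective nbr nbr-injective adj {a} {b} eq with a Fin.≟ b
    ... | yes a≡b = a≡b
    ... | no a≢b  = ⊥-elim (common-neighbour⇒labels-distinct (adj a) (adj b) (a≢b ∘ nbr-injective) eq)

    high-degree⇒label-extreme : ∀ {m v} (nbr : Fin m → V G) → Injective _≡_ _≡_ nbr →
                                (∀ a → Adj G (nbr a) v) → k ≤ suc m → L v ≡ 0 ⊎ L v ≡ k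
    high-degree⇒label-extreme {v = v} nbr nbr-injective adj =
      injective-far⇒extreme (L ∘ nbr) (label-≤ ∘ nbr) (adjacent-labels-far ∘ adj)
        (neighbour-labels-injective nbr nbr-injective adj) (label-≤ v)

    neighbour-of-0 : ∀ {u v} → L v ≡ 0 → Adj G u v → 2 ≤ L u
    neighbour-of-0 {u} Lv≡0 uv =
      subst (2 ≤_) (trans (cong (∣ L u -_∣) Lv≡0) (∣-∣-identityʳ (L u))) (adjacent-labels-far uv)

    neighbour-of-k : ∀ {u v} → L v ≡ k → Adj G u v → 2 + L u ≤ k
    neighbour-of-k {u} Lv≡k uv =
      2≤∣m-n∣⇒2+m≤n (label-≤ u) (subst (λ ℓ → 2 ≤ ∣ L u - ℓ ∣) Lv≡k (adjacent-labels-far uv))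

  complement-IsL21 : ∀ {k G L} → IsL21 k G L → IsL21 k G (λ v → k ∸ L v)
  complement-IsL21 {k} {L = L} (L≤k , far , distinct) =
    (λ v → m∸n≤m k (L v)) ,
    (λ u v uv → subst (2 ≤_) (sym (∣k∸m-k∸n∣≡∣m-n∣ (L≤k u) (L≤k v))) (far u v uv)) ,
    (λ u v d2 → distinct u v d2 ∘ ∸-cancelˡ-≡ (L≤k u) (L≤k v))

  ∷-injective : ∀ {A : Set} {n} {x : A} {φ : Fin n → A} →
                (∀ j → x ≢ φ j) → Injective _≡_ _≡_ φ → Injective _≡_ _≡_ (x ∷ φ)
  ∷-injective x∉φ φ-injective {Fin.zero}  {Fin.zero}  _  = refl
  ∷-injective x∉φ φ-injective {Fin.zero}  {Fin.suc b} eq = ⊥-elim (x∉φ b eq)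
  ∷-injective x∉φ φ-injective {Fin.suc a} {Fin.zero}  eq = ⊥-elim (x∉φ a (sym eq))
  ∷-injective x∉φ φ-injective {Fin.suc a} {Fin.suc b} eq = cong Fin.suc (φ-injective eq)

  f-injective : ∀ {k} → Injective _≡_ _≡_ (f {k})
  f-injective refl = refl

  module _ {n : ℕ} {L : VH (4 + n) → ℕ} (isL : IsL21 (4 + n) (H' (4 + n)) L) where

    open IsL21-Properties {G = H' (4 + n)} isL

    d-neighbours g-neighbours : Fin (3 + n) → VH (4 + n)
    d-neighbours = c ∷ e ∷ f
    g-neighbours = h ∷ i ∷ f

    d-neighbours-adjacent : ∀ a → AdjH (4 + n) (d-neighbours a) d
    d-neighbours-adjacent Fin.zero                = inj₁ cd
    d-neighbours-adjacent (Fin.suc Fin.zero)      = inj₂ de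
    d-neighbours-adjacent (Fin.suc (Fin.suc j))   = inj₂ (df j)

    g-neighbours-adjacent : ∀ a → AdjH (4 + n) (g-neighbours a) g
    g-neighbours-adjacent Fin.zero                = inj₁ hg
    g-neighbours-adjacent (Fin.suc Fin.zero)      = inj₂ gi
    g-neighbours-adjacent (Fin.suc (Fin.suc j))   = inj₂ (gf j)

    d-label-extreme : L d ≡ 0 ⊎ L d ≡ 4 + n
    d-label-extreme = high-degree⇒label-extreme d-neighbours
      (∷-injective (λ { Fin.zero () ; (Fin.suc _) () }) (∷-injective (λ _ ()) f-injective))
      d-neighbours-adjacent ≤-refl

    g-label-extreme : L g ≡ 0 ⊎ L g ≡ 4 + n
    g-label-extreme = high-degree⇒label-extreme g-neighbours
      (∷-injective (λ { Fin.zero () ; (Fin.suc _) () }) (∷-injective (λ _ ()) f-injective))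
      g-neighbours-adjacent ≤-refl

    d-label≢g-label : L d ≢ L g
    d-label≢g-label = common-neighbour⇒labels-distinct (inj₁ (df Fin.zero)) (inj₁ (gf Fin.zero)) λ ()

    d-label≡k⇒c-label≤1 : L d ≡ 4 + n → L c ≤ 1
    d-label≡k⇒c-label≤1 Ld≡k = s≤s⁻¹ (≰⇒> λ 2≤Lc → 1+n≰n
      (injective-into-interval⇒≤ 2 (L ∘ (c ∷ f)) (lower 2≤Lc) upper
        (neighbour-labels-injective (c ∷ f) (∷-injective (λ _ ()) f-injective) adjacent)))
      where
      Lg≡0 : L g ≡ 0
      Lg≡0 with g-label-extreme
      ... | inj₁ Lg≡0 = Lg≡0
      ... | inj₂ Lg≡k = ⊥-elim (d-label≢g-label (trans Ld≡k (sym Lg≡k)))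

      adjacent : ∀ a → AdjH (4 + n) ((c ∷ f) a) d
      adjacent Fin.zero    = inj₁ cd
      adjacent (Fin.suc j) = inj₂ (df j)

      lower : 2 ≤ L c → ∀ a → 2 ≤ L ((c ∷ f) a)
      lower 2≤Lc Fin.zero    = 2≤Lc
      lower _    (Fin.suc j) = neighbour-of-0 Lg≡0 (inj₂ (gf j))

      upper : ∀ a → L ((c ∷ f) a) ≤ 2 + n
      upper a = s≤s⁻¹ (s≤s⁻¹ (neighbour-of-k Ld≡k (adjacent a)))

  ExtremalPair : ℕ → ℕ → ℕ → Set
  ExtremalPair k x y = (x ≡ 0 × y ≡ k) ⊎ (x ≡ 1 × y ≡ k) ⊎ (x ≡ k ∸ 1 × y ≡ 0) ⊎ (x ≡ k × y ≡ 0)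

  H'-labels-extremal : ∀ {k L} → 4 ≤ k → IsL21 k (H' k) L → ExtremalPair k (L c) (L d)
  H'-labels-extremal {k} {L} (s≤s (s≤s (s≤s (s≤s _)))) isL with d-label-extreme isL
  ... | inj₂ Ld≡k = Sum.map (_, Ld≡k) (λ Lc≡1 → inj₁ (Lc≡1 , Ld≡k)) (≤1⇒≡0⊎≡1 (d-label≡k⇒c-label≤1 isL Ld≡k))
  ... | inj₁ Ld≡0 = inj₂ (inj₂ (Sum.swap (Sum.map (_, Ld≡0) (_, Ld≡0)
                                                   (Sum.map mirror mirror (≤1⇒≡0⊎≡1 mirrored-c-label≤1)))))
    where
    mirrored-c-label≤1 : k ∸ L c ≤ 1
    mirrored-c-label≤1 = d-label≡k⇒c-label≤1 (complement-IsL21 {G = H' k} isL) (cong (k ∸_) Ld≡0)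

    mirror : ∀ {r} → k ∸ L c ≡ r → L c ≡ k ∸ r
    mirror eq = trans (sym (m∸[m∸n]≡n (IsL21-Properties.label-≤ {G = H' k} isL c))) (cong (k ∸_) eq)

  module ExtremalLabelling {n p q : ℕ} (p≤1 : p ≤ 1) (q≤1 : q ≤ 1) (p≢q : p ≢ q) where

    label : VH (3 + n) → ℕ
    label c     = p
    label e     = q
    label d     = 3 + n
    label g     = 0
    label h     = 2 + n
    label i     = 3 + n
    label (f j) = 2 + toℕ j

    ≤1⇒2+m≤3+n : ∀ {m} → m ≤ 1 → 2 + m ≤ 3 + n
    ≤1⇒2+m≤3+n m≤1 = ≤-trans (+-monoʳ-≤ 2 m≤1) (m≤m+n 3 n)

    label-≤ : ∀ v → label v ≤ 3 + n
    label-≤ c     = ≤-trans p≤1 (s≤s z≤n)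
    label-≤ e     = ≤-trans q≤1 (s≤s z≤n)
    label-≤ d     = ≤-refl
    label-≤ g     = z≤n
    label-≤ h     = n≤1+n _
    label-≤ i     = ≤-refl
    label-≤ (f j) = s≤s (s≤s (m<n⇒m≤1+n (toℕ<n j)))

    edge-labels-far : ∀ {u v} → EH (3 + n) u v → 2 ≤ ∣ label u - label v ∣
    edge-labels-far cd     = 2+m≤n⇒2≤∣m-n∣ (≤1⇒2+m≤3+n p≤1)
    edge-labels-far de     = subst (2 ≤_) (∣-∣-comm q (3 + n)) (2+m≤n⇒2≤∣m-n∣ (≤1⇒2+m≤3+n q≤1))
    edge-labels-far hg     = s≤s (s≤s z≤n)
    edge-labels-far gi     = s≤s (s≤s z≤n)
    edge-labels-far (gf j) = s≤s (s≤s z≤n)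
    edge-labels-far (df j) = subst (2 ≤_) (∣-∣-comm (toℕ j) (suc n)) (2+m≤n⇒2≤∣m-n∣ (s≤s (toℕ<n j)))

    adjacent-labels-far : ∀ u v → AdjH (3 + n) u v → 2 ≤ ∣ label u - label v ∣
    adjacent-labels-far u v (inj₁ uv) = edge-labels-far uv
    adjacent-labels-far u v (inj₂ vu) = subst (2 ≤_) (∣-∣-comm (label v) (label u)) (edge-labels-far vu)

    label-h≢label-i : label h ≢ label i
    label-h≢label-i = 1+n≢n ∘ sym

    label-h≢label-f : ∀ j → label h ≢ label (f j)
    label-h≢label-f j eq = <-irrefl (sym (+-cancelˡ-≡ 2 n (toℕ j) eq)) (toℕ<n j)

    label-i≢label-f : ∀ j → label i ≢ label (f j)
    label-i≢label-f j eq = <-irrefl (sym (+-cancelˡ-≡ 2 (suc n) (toℕ j) eq)) (m<n⇒m<1+n (toℕ<n j))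

    label-f-injective : ∀ {j j′} → f {3 + n} j ≢ f j′ → label (f j) ≢ label (f j′)
    label-f-injective fj≢fj′ = fj≢fj′ ∘ cong f ∘ toℕ-injective ∘ +-cancelˡ-≡ 2 _ _

    distance-2-labels-distinct : ∀ {u v w} → AdjH (3 + n) u w → AdjH (3 + n) w v → u ≢ v → label u ≢ label v
    distance-2-labels-distinct (inj₂ cd)     (inj₁ cd)     u≢v = ⊥-elim (u≢v refl)
    distance-2-labels-distinct (inj₁ de)     (inj₂ de)     u≢v = ⊥-elim (u≢v refl)
    distance-2-labels-distinct (inj₂ hg)     (inj₁ hg)     u≢v = ⊥-elim (u≢v refl)
    distance-2-labels-distinct (inj₁ gi)     (inj₂ gi)     u≢v = ⊥-elim (u≢v refl)
    distance-2-labels-distinct (inj₁ cd)     (inj₂ cd)     u≢v = ⊥-elim (u≢v refl)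
    distance-2-labels-distinct (inj₁ cd)     (inj₁ de)     _   = p≢q
    distance-2-labels-distinct (inj₁ cd)     (inj₁ (df _)) _   = ≤1⇒≢2+ p≤1
    distance-2-labels-distinct (inj₂ de)     (inj₂ cd)     _   = p≢q ∘ sym
    distance-2-labels-distinct (inj₂ de)     (inj₁ de)     u≢v = ⊥-elim (u≢v refl)
    distance-2-labels-distinct (inj₂ de)     (inj₁ (df _)) _   = ≤1⇒≢2+ q≤1
    distance-2-labels-distinct (inj₂ (df _)) (inj₂ cd)     _   = ≤1⇒≢2+ p≤1 ∘ sym
    distance-2-labels-distinct (inj₂ (df _)) (inj₁ de)     _   = ≤1⇒≢2+ q≤1 ∘ sym
    distance-2-labels-distinct (inj₂ (df _)) (inj₁ (df _)) u≢v = label-f-injective u≢v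
    distance-2-labels-distinct (inj₁ hg)     (inj₂ hg)     u≢v = ⊥-elim (u≢v refl)
    distance-2-labels-distinct (inj₁ hg)     (inj₁ gi)     _   = label-h≢label-i
    distance-2-labels-distinct (inj₁ hg)     (inj₁ (gf j)) _   = label-h≢label-f j
    distance-2-labels-distinct (inj₂ gi)     (inj₂ hg)     _   = label-h≢label-i ∘ sym
    distance-2-labels-distinct (inj₂ gi)     (inj₁ gi)     u≢v = ⊥-elim (u≢v refl)
    distance-2-labels-distinct (inj₂ gi)     (inj₁ (gf j)) _   = label-i≢label-f j
    distance-2-labels-distinct (inj₂ (gf j)) (inj₂ hg)     _   = label-h≢label-f j ∘ sym
    distance-2-labels-distinct (inj₂ (gf j)) (inj₁ gi)     _   = label-i≢label-f j ∘ sym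
    distance-2-labels-distinct (inj₂ (gf _)) (inj₁ (gf _)) u≢v = label-f-injective u≢v
    distance-2-labels-distinct (inj₁ (gf _)) (inj₂ (gf _)) u≢v = ⊥-elim (u≢v refl)
    distance-2-labels-distinct (inj₁ (gf _)) (inj₂ (df _)) _   = λ ()
    distance-2-labels-distinct (inj₁ (df _)) (inj₂ (gf _)) _   = λ ()
    distance-2-labels-distinct (inj₁ (df _)) (inj₂ (df _)) u≢v = ⊥-elim (u≢v refl)

    label-IsL21 : IsL21 (3 + n) (H' (3 + n)) label
    label-IsL21 = label-≤ , adjacent-labels-far ,
                  λ u v (u≢v , _ , _ , uw , wv) → distance-2-labels-distinct uw wv u≢v

  H'-labelling-d≡k : ∀ {k b} → 3 ≤ k → b ≤ 1 → ∃[ L ] (IsL21 k (H' k) L × L c ≡ b × L d ≡ k)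
  H'-labelling-d≡k {b = b} (s≤s (s≤s (s≤s _))) b≤1 = label , label-IsL21 , refl , refl
    where open ExtremalLabelling b≤1 (m∸n≤m 1 b) (≤1⇒≢1∸ b≤1)

  complement-labelling : ∀ {k G u v a} → ∃[ L ] (IsL21 k G L × L u ≡ a × L v ≡ k) →
                         ∃[ L ] (IsL21 k G L × L u ≡ k ∸ a × L v ≡ 0)
  complement-labelling {k} {G} (L , isL , Lu≡a , Lv≡k) =
    (λ w → k ∸ L w) , complement-IsL21 {G = G} isL , cong (k ∸_) Lu≡a , trans (cong (k ∸_) Lv≡k) (n∸n≡0 k)

  H'-has-extremal-labelling : ∀ {k x y} → 3 ≤ k → ExtremalPair k x y →
                              ∃[ L ] (IsL21 k (H' k) L × L c ≡ x × L d ≡ y)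
  H'-has-extremal-labelling 3≤k (inj₁ (refl , refl))               = H'-labelling-d≡k 3≤k z≤n
  H'-has-extremal-labelling 3≤k (inj₂ (inj₁ (refl , refl)))        = H'-labelling-d≡k 3≤k (s≤s z≤n)
  H'-has-extremal-labelling 3≤k (inj₂ (inj₂ (inj₁ (refl , refl)))) =
    complement-labelling {G = H' _} (H'-labelling-d≡k 3≤k (s≤s z≤n))
  H'-has-extremal-labelling 3≤k (inj₂ (inj₂ (inj₂ (refl , refl)))) =
    complement-labelling {G = H' _} (H'-labelling-d≡k 3≤k z≤n)

module Drawing where

  open import Data.Nat as ℕ using (ℕ; zero; suc)
  import Data.Nat.Properties as ℕ
  open import Data.Rational using (ℚ; 0ℚ; 1ℚ; _+_; _*_; _-_; -_; _≤_; _<_; 1/_; ≢-nonZero)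
  open import Data.Rational.Properties
  open import Data.Rational.Solver using (module +-*-Solver)
  open import Algebra.Properties.Group +-0-group using (∙-cancelˡ; x∙y⁻¹≈ε⇒x≈y)
  open import Data.Product as Prod using (_×_; _,_; proj₁; proj₂)
  open import Data.Sum as Sum using (_⊎_; inj₁; inj₂)
  open import Relation.Binary.Definitions using (tri<; tri≈; tri>)
  open import Data.Fin as Fin using (toℕ)
  open import Data.Fin.Properties using (fromℕ<-toℕ; toℕ<n)
  open import Relation.Binary.PropositionalEquality
  open import Relation.Nullary using (¬_; yes; no)
  open import Function using (_∘_)
  open import Data.Empty using (⊥-elim)
  open +-*-Solver

  SameEdge-swapʳ : ∀ {X : Set} {u v w z : X} → SameEdge u v z w → SameEdge u v w z
  SameEdge-swapʳ = Sum.swap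

  SameEdge-swapˡ : ∀ {X : Set} {u v w z : X} → SameEdge v u w z → SameEdge u v w z
  SameEdge-swapˡ = Sum.swap ∘ Sum.map Prod.swap Prod.swap

  -- Recursive rather than + n / 1, so that ι (suc n) = ι n + 1ℚ holds by definition.
  ι : ℕ → ℚ
  ι zero    = 0ℚ
  ι (suc n) = ι n + 1ℚ

  ι<ι[1+n] : ∀ n → ι n < ι (suc n)
  ι<ι[1+n] n = subst (_< ι n + 1ℚ) (+-identityʳ (ι n)) (+-monoʳ-< (ι n) (positive⁻¹ 1ℚ))

  ι-mono-≤ : ∀ {m n} → m ℕ.≤ n → ι m ≤ ι n
  ι-mono-≤ {n = zero}  ℕ.z≤n      = ≤-refl
  ι-mono-≤ {n = suc n} ℕ.z≤n      = ≤-trans (ι-mono-≤ {n = n} ℕ.z≤n) (<⇒≤ (ι<ι[1+n] n))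
  ι-mono-≤             (ℕ.s≤s m≤n) = +-monoˡ-≤ 1ℚ (ι-mono-≤ m≤n)

  ι-cancel-≤ : ∀ {m n} → ι m ≤ ι n → m ℕ.≤ n
  ι-cancel-≤ {m} {n} ιm≤ιn with m ℕ.≤? n
  ... | yes m≤n = m≤n
  ... | no m≰n  = ⊥-elim (<-irrefl refl (<-≤-trans (<-≤-trans (ι<ι[1+n] n) (ι-mono-≤ (ℕ.≰⇒> m≰n))) ιm≤ιn))

  ι-injective : ∀ {m n} → ι m ≡ ι n → m ≡ n
  ι-injective eq = ℕ.≤-antisym (ι-cancel-≤ (≤-reflexive eq)) (ι-cancel-≤ (≤-reflexive (sym eq)))

  x≢y⇒x-y≢0 : ∀ {x y} → x ≢ y → x - y ≢ 0ℚ
  x≢y⇒x-y≢0 {x} {y} x≢y = x≢y ∘ x∙y⁻¹≈ε⇒x≈y x y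

  x*y≡0⇒x≡0 : ∀ x y → y ≢ 0ℚ → x * y ≡ 0ℚ → x ≡ 0ℚ
  x*y≡0⇒x≡0 x y y≢0 xy≡0 = begin
    x              ≡⟨ *-identityʳ x ⟨
    x * 1ℚ         ≡⟨ cong (x *_) (*-inverseʳ y) ⟨
    x * (y * 1/ y) ≡⟨ *-assoc x y (1/ y) ⟨
    x * y * 1/ y   ≡⟨ cong (_* 1/ y) xy≡0 ⟩
    0ℚ * 1/ y      ≡⟨ *-zeroˡ (1/ y) ⟩
    0ℚ             ∎
    where
    open ≡-Reasoning
    instance
      y-nonZero = ≢-nonZero y≢0

  OnSeg-sym : ∀ {p} a b → OnSeg p a b → OnSeg p b a
  OnSeg-sym (a₁ , a₂) (b₁ , b₂) (t , 0≤t , t≤1 , p≡) =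
    1ℚ - t , 0≤1-t , +-monoʳ-≤ 1ℚ (neg-antimono-≤ 0≤t) , trans p≡ (cong₂ _,_ (reverse a₁ b₁) (reverse a₂ b₂))
    where
    0≤1-t : 0ℚ ≤ 1ℚ - t
    0≤1-t = subst (_≤ 1ℚ - t) (+-inverseʳ t) (+-monoˡ-≤ (- t) t≤1)
    reverse : ∀ x y → x + t * (y - x) ≡ y + (1ℚ - t) * (x - y)
    reverse = solve 3 (λ t x y → x :+ t :* (y :- x) := y :+ (con 1ℚ :- t) :* (x :- y)) refl t

  OnSeg-start : ∀ {p} a b (s : OnSeg p a b) → proj₁ s ≡ 0ℚ → p ≡ a
  OnSeg-start (a₁ , a₂) (b₁ , b₂) (t , _ , _ , p≡) refl = trans p≡ (cong₂ _,_ (start a₁ b₁) (start a₂ b₂))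
    where
    start : ∀ x y → x + 0ℚ * (y - x) ≡ x
    start = solve 2 (λ x y → x :+ con 0ℚ :* (y :- x) := x) refl

  OnSeg-end : ∀ {p} a b (s : OnSeg p a b) → proj₁ s ≡ 1ℚ → p ≡ b
  OnSeg-end (a₁ , a₂) (b₁ , b₂) (t , _ , _ , p≡) refl = trans p≡ (cong₂ _,_ (end a₁ b₁) (end a₂ b₂))
    where
    end : ∀ x y → x + 1ℚ * (y - x) ≡ y
    end = solve 2 (λ x y → x :+ con 1ℚ :* (y :- x) := y) refl

  Rises : Point → Point → Set
  Rises a b = proj₂ b ≡ proj₂ a + 1ℚ

  OnSeg-height : ∀ {p} a b → Rises a b → (s : OnSeg p a b) → proj₂ p ≡ proj₂ a + proj₁ s
  OnSeg-height (_ , a₂) (_ , b₂) refl (t , _ , _ , p≡) =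
    trans (cong proj₂ p≡) (solve 2 (λ y t → y :+ t :* ((y :+ con 1ℚ) :- y) := y :+ t) refl a₂ t)

  OnSeg-above : ∀ {p} a b → Rises a b → OnSeg p a b → proj₂ a ≤ proj₂ p
  OnSeg-above a b rises s@(_ , 0≤t , _ , _) =
    subst₂ _≤_ (+-identityʳ (proj₂ a)) (sym (OnSeg-height a b rises s)) (+-monoʳ-≤ (proj₂ a) 0≤t)

  OnSeg-below : ∀ {p} a b → Rises a b → OnSeg p a b → proj₂ p ≤ proj₂ b
  OnSeg-below a b rises s@(_ , _ , t≤1 , _) =
    subst₂ _≤_ (sym (OnSeg-height a b rises s)) (sym rises) (+-monoʳ-≤ (proj₂ a) t≤1)

  OnSeg-bottom : ∀ {p} a b → Rises a b → (s : OnSeg p a b) → proj₂ p ≡ proj₂ a → p ≡ a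
  OnSeg-bottom a b rises s p₂≡a₂ = OnSeg-start a b s (∙-cancelˡ (proj₂ a) _ _
    (trans (sym (OnSeg-height a b rises s)) (trans p₂≡a₂ (sym (+-identityʳ (proj₂ a))))))

  OnSeg-top : ∀ {p} a b → Rises a b → (s : OnSeg p a b) → proj₂ p ≡ proj₂ b → p ≡ b
  OnSeg-top a b rises s p₂≡b₂ = OnSeg-end a b s (∙-cancelˡ (proj₂ a) _ _
    (trans (sym (OnSeg-height a b rises s)) (trans p₂≡b₂ rises)))

  OnSeg-fan : ∀ {p} a b b′ (s : OnSeg p a b) (s′ : OnSeg p a b′) →
              proj₁ s ≡ proj₁ s′ → proj₁ b ≢ proj₁ b′ → p ≡ a
  OnSeg-fan {p} a@(a₁ , _) b@(b₁ , _) (b₁′ , _) s@(t , _ , _ , p≡) (_ , _ , _ , p≡′) refl b₁≢b₁′ =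
    OnSeg-start a b s (x*y≡0⇒x≡0 t (b₁ - b₁′) (x≢y⇒x-y≢0 b₁≢b₁′) (begin
      t * (b₁ - b₁′)                               ≡⟨ separate a₁ b₁ b₁′ t ⟩
      (a₁ + t * (b₁ - a₁)) - (a₁ + t * (b₁′ - a₁)) ≡⟨ cong₂ _-_ (cong proj₁ p≡) (cong proj₁ p≡′) ⟨
      proj₁ p - proj₁ p                            ≡⟨ +-inverseʳ (proj₁ p) ⟩
      0ℚ                                           ∎))
    where
    open ≡-Reasoning
    separate : ∀ a b b′ t → t * (b - b′) ≡ (a + t * (b - a)) - (a + t * (b′ - a))
    separate = solve 4 (λ a b b′ t → t :* (b :- b′) := (a :+ t :* (b :- a)) :- (a :+ t :* (b′ :- a))) refl

  module LevelledDrawing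
    (G : Graph) (x level : V G → ℕ) (hub : ℕ → V G)
    (coordinates-injective : ∀ {u v} → x u ≡ x v → level u ≡ level v → u ≡ v)
    (adjacent-levels : ∀ {u v} → Adj G u v → level v ≡ suc (level u) ⊎ level u ≡ suc (level v))
    (bands-are-stars : ∀ {u v} → Adj G u v → level v ≡ suc (level u) → u ≡ hub (level u) ⊎ v ≡ hub (level u))
    where

    position : V G → Point
    position v = ι (x v) , ι (level v)

    position-injective : ∀ {u v} → position u ≡ position v → u ≡ v
    position-injective eq = coordinates-injective (ι-injective (cong proj₁ eq)) (ι-injective (cong proj₂ eq))

    Up : V G → V G → Set
    Up u v = Adj G u v × level v ≡ suc (level u)

    up-rises : ∀ {u v} → Up u v → Rises (position u) (position v)
    up-rises (_ , level-v≡) = cong ι level-v≡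

    same-level⇒ιx≢ : ∀ {u v} → u ≢ v → level u ≡ level v → ι (x u) ≢ ι (x v)
    same-level⇒ιx≢ u≢v level-u≡ ιx-u≡ = u≢v (coordinates-injective (ι-injective ιx-u≡) level-u≡)

    module _ {u v : V G} (up : Up u v) {p : Point} (s : OnSeg p (position u) (position v)) where

      up-height : proj₂ p ≡ ι (level u) + proj₁ s
      up-height = OnSeg-height (position u) (position v) (up-rises up) s

      up-above : ι (level u) ≤ proj₂ p
      up-above = OnSeg-above (position u) (position v) (up-rises up) s

      up-below : proj₂ p ≤ ι (level v)
      up-below = OnSeg-below (position u) (position v) (up-rises up) s

      up-bottom : proj₂ p ≡ ι (level u) → p ≡ position u
      up-bottom = OnSeg-bottom (position u) (position v) (up-rises up) s

      up-top : proj₂ p ≡ ι (level v) → p ≡ position v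
      up-top = OnSeg-top (position u) (position v) (up-rises up) s

    vertex-off-up-edge : ∀ {u v} w → Up u v → w ≢ u → w ≢ v → ¬ OnSeg (position w) (position u) (position v)
    vertex-off-up-edge w up w≢u w≢v s with ℕ.m≤n⇒m<n∨m≡n (ι-cancel-≤ (up-above up s))
    ... | inj₂ level-u≡ = w≢u (position-injective (up-bottom up s (cong ι (sym level-u≡))))
    ... | inj₁ level-u< = w≢v (position-injective (up-top up s (cong ι (ℕ.≤-antisym
            (ι-cancel-≤ (up-below up s)) (subst (ℕ._≤ level w) (sym (proj₂ up)) level-u<)))))

    EndpointOfBoth : V G → V G → V G → V G → Point → Set
    EndpointOfBoth u v w z p = (p ≡ position u ⊎ p ≡ position v) × (p ≡ position w ⊎ p ≡ position z)

    stacked-up-edges-meet : ∀ {u v w z p} → Up u v → Up w z → level u ℕ.< level w →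
                            OnSeg p (position u) (position v) → OnSeg p (position w) (position z) →
                            EndpointOfBoth u v w z p
    stacked-up-edges-meet {v = v} {w} {p = p} uv wz level-u< s s′ =
      inj₂ (up-top uv s p₂≡) , inj₁ (up-bottom wz s′ (trans p₂≡ (cong ι level-v≡level-w)))
      where
      level-v≡level-w : level v ≡ level w
      level-v≡level-w = ℕ.≤-antisym (subst (ℕ._≤ level w) (sym (proj₂ uv)) level-u<)
                                    (ι-cancel-≤ (≤-trans (up-above wz s′) (up-below uv s)))
      p₂≡ : proj₂ p ≡ ι (level v)
      p₂≡ = ≤-antisym (up-below uv s) (subst (_≤ proj₂ p) (cong ι (sym level-v≡level-w)) (up-above wz s′))

    band-edges-share-endpoint : ∀ {u v w z} → Up u v → Up w z → level u ≡ level w → u ≡ w ⊎ v ≡ z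
    band-edges-share-endpoint {u} {v} {w} {z} (uv , level-v≡) (wz , level-z≡) level-u≡level-w
      with bands-are-stars uv level-v≡
         | subst (λ ℓ → w ≡ hub ℓ ⊎ z ≡ hub ℓ) (sym level-u≡level-w) (bands-are-stars wz level-z≡)
    ... | inj₁ u≡hub | inj₁ w≡hub = inj₁ (trans u≡hub (sym w≡hub))
    ... | inj₂ v≡hub | inj₂ z≡hub = inj₂ (trans v≡hub (sym z≡hub))
    ... | inj₁ u≡hub | inj₂ z≡hub = ⊥-elim (ℕ.1+n≢n (begin
      suc (level u) ≡⟨ cong suc level-u≡level-w ⟩
      suc (level w) ≡⟨ level-z≡ ⟨
      level z       ≡⟨ cong level (trans z≡hub (sym u≡hub)) ⟩
      level u       ∎))
      where open ≡-Reasoning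
    ... | inj₂ v≡hub | inj₁ w≡hub = ⊥-elim (ℕ.1+n≢n (begin
      suc (level u) ≡⟨ level-v≡ ⟨
      level v       ≡⟨ cong level (trans v≡hub (sym w≡hub)) ⟩
      level w       ≡⟨ level-u≡level-w ⟨
      level u       ∎))
      where open ≡-Reasoning

    same-band-parameters-equal : ∀ {u v w z p} → Up u v → Up w z → level u ≡ level w →
                                 (s : OnSeg p (position u) (position v)) (s′ : OnSeg p (position w) (position z)) →
                                 proj₁ s ≡ proj₁ s′
    same-band-parameters-equal {u} {w = w} {p = p} uv wz level-u≡level-w s s′ = ∙-cancelˡ (ι (level u)) _ _ (begin
      ι (level u) + proj₁ s  ≡⟨ up-height uv s ⟨
      proj₂ p                ≡⟨ up-height wz s′ ⟩
      ι (level w) + proj₁ s′ ≡⟨ cong (λ ℓ → ι ℓ + proj₁ s′) level-u≡level-w ⟨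
      ι (level u) + proj₁ s′ ∎)
      where open ≡-Reasoning

    same-band-up-edges-meet : ∀ {u v w z p} → Up u v → Up w z → level u ≡ level w → ¬ SameEdge u v w z →
                              OnSeg p (position u) (position v) → OnSeg p (position w) (position z) →
                              EndpointOfBoth u v w z p
    same-band-up-edges-meet {u} {v} {w} {z} {p} uv wz level-u≡level-w ¬same s s′
      with band-edges-share-endpoint uv wz level-u≡level-w
    ... | inj₁ refl = inj₁ p≡u , inj₁ p≡u
      where
      p≡u : p ≡ position u
      p≡u = OnSeg-fan (position u) (position v) (position z) s s′ (same-band-parameters-equal uv wz level-u≡level-w s s′)
              (same-level⇒ιx≢ (λ v≡z → ¬same (inj₁ (refl , v≡z))) (trans (proj₂ uv) (sym (proj₂ wz))))
    ... | inj₂ refl = inj₂ p≡v , inj₂ p≡v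
      where
      p≡v : p ≡ position v
      p≡v = OnSeg-fan (position v) (position u) (position w)
              (OnSeg-sym (position u) (position v) s) (OnSeg-sym (position w) (position v) s′)
              (cong (λ t → 1ℚ - t) (same-band-parameters-equal uv wz level-u≡level-w s s′))
              (same-level⇒ιx≢ (λ u≡w → ¬same (inj₁ (u≡w , refl))) level-u≡level-w)

    up-edges-meet : ∀ {u v w z p} → Up u v → Up w z → ¬ SameEdge u v w z →
                    OnSeg p (position u) (position v) → OnSeg p (position w) (position z) →
                    EndpointOfBoth u v w z p
    up-edges-meet {u} {w = w} uv wz ¬same s s′ with ℕ.<-cmp (level u) (level w)
    ... | tri< level-u< _ _ = stacked-up-edges-meet uv wz level-u< s s′
    ... | tri≈ _ level-u≡ _ = same-band-up-edges-meet uv wz level-u≡ ¬same s s′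
    ... | tri> _ _ level-w< = Prod.swap (stacked-up-edges-meet wz uv level-w< s′ s)

    orient : ∀ {u v} → Adj G u v → Up u v ⊎ Up v u
    orient uv = Sum.map (uv ,_) (Graph.sym G uv ,_) (adjacent-levels uv)

    vertices-off-edges : ∀ w u v → Adj G u v → w ≢ u → w ≢ v → ¬ OnSeg (position w) (position u) (position v)
    vertices-off-edges w u v uv w≢u w≢v with orient uv
    ... | inj₁ up = vertex-off-up-edge w up w≢u w≢v
    ... | inj₂ up = vertex-off-up-edge w up w≢v w≢u ∘ OnSeg-sym (position u) (position v)

    edges-meet-at-endpoints : ∀ u v w z → Adj G u v → Adj G w z → ¬ SameEdge u v w z →
                              ∀ p → OnSeg p (position u) (position v) → OnSeg p (position w) (position z) →
                              EndpointOfBoth u v w z p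
    edges-meet-at-endpoints u v w z uv wz ¬same p s s′ with orient uv | orient wz
    ... | inj₁ up | inj₁ up′ = up-edges-meet up up′ ¬same s s′
    ... | inj₁ up | inj₂ up′ = Prod.map₂ Sum.swap
      (up-edges-meet up up′ (¬same ∘ SameEdge-swapʳ) s (OnSeg-sym (position w) (position z) s′))
    ... | inj₂ up | inj₁ up′ = Prod.map₁ Sum.swap
      (up-edges-meet up up′ (¬same ∘ SameEdge-swapˡ) (OnSeg-sym (position u) (position v) s) s′)
    ... | inj₂ up | inj₂ up′ = Prod.map Sum.swap Sum.swap
      (up-edges-meet up up′ (¬same ∘ SameEdge-swapʳ ∘ SameEdge-swapˡ)
        (OnSeg-sym (position u) (position v) s) (OnSeg-sym (position w) (position z) s′))

    straight-line-drawing : StraightLineDrawing G position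
    straight-line-drawing = position-injective , vertices-off-edges , edges-meet-at-endpoints

  module _ {k : ℕ} where

    x-coordinate level : VH k → ℕ
    x-coordinate c     = 0
    x-coordinate e     = 2
    x-coordinate d     = 1
    x-coordinate (f j) = toℕ j
    x-coordinate g     = 1
    x-coordinate h     = 0
    x-coordinate i     = 2
    level c     = 4
    level e     = 4
    level d     = 3
    level (f j) = 2
    level g     = 1
    level h     = 0
    level i     = 0

    -- A left inverse of (level , x-coordinate); its value at unused coordinates is arbitrary.
    vertex-at : ℕ → ℕ → VH k
    vertex-at 4 0 = c
    vertex-at 4 _ = e
    vertex-at 2 j with j ℕ.<? k ℕ.∸ 3
    ... | yes j<k∸3 = f (Fin.fromℕ< j<k∸3)
    ... | no _      = d
    vertex-at 1 _ = g
    vertex-at 0 0 = h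
    vertex-at 0 _ = i
    vertex-at _ _ = d

    vertex-at-coordinates : ∀ v → vertex-at (level v) (x-coordinate v) ≡ v
    vertex-at-coordinates c = refl
    vertex-at-coordinates e = refl
    vertex-at-coordinates d = refl
    vertex-at-coordinates (f j) with toℕ j ℕ.<? k ℕ.∸ 3
    ... | yes j<k∸3 = cong f (fromℕ<-toℕ j j<k∸3)
    ... | no j≮k∸3  = ⊥-elim (j≮k∸3 (toℕ<n j))
    vertex-at-coordinates g = refl
    vertex-at-coordinates h = refl
    vertex-at-coordinates i = refl

    coordinates-injective : ∀ {u v} → x-coordinate u ≡ x-coordinate v → level u ≡ level v → u ≡ v
    coordinates-injective {u} {v} x≡ level≡ =
      trans (sym (vertex-at-coordinates u)) (trans (cong₂ vertex-at level≡ x≡) (vertex-at-coordinates v))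

    edge-levels : ∀ {u v} → EH k u v → level v ≡ suc (level u) ⊎ level u ≡ suc (level v)
    edge-levels cd     = inj₂ refl
    edge-levels de     = inj₁ refl
    edge-levels hg     = inj₁ refl
    edge-levels gi     = inj₂ refl
    edge-levels (gf _) = inj₁ refl
    edge-levels (df _) = inj₂ refl

    adjacent-levels : ∀ {u v} → AdjH k u v → level v ≡ suc (level u) ⊎ level u ≡ suc (level v)
    adjacent-levels (inj₁ uv) = edge-levels uv
    adjacent-levels (inj₂ vu) = Sum.swap (edge-levels vu)

    hub : ℕ → VH k
    hub 0 = g
    hub 1 = g
    hub _ = d

    bands-are-stars : ∀ {u v} → AdjH k u v → level v ≡ suc (level u) → u ≡ hub (level u) ⊎ v ≡ hub (level u)
    bands-are-stars (inj₁ cd)     ()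
    bands-are-stars (inj₂ cd)     _  = inj₁ refl
    bands-are-stars (inj₁ de)     _  = inj₁ refl
    bands-are-stars (inj₂ de)     ()
    bands-are-stars (inj₁ hg)     _  = inj₂ refl
    bands-are-stars (inj₂ hg)     ()
    bands-are-stars (inj₁ gi)     ()
    bands-are-stars (inj₂ gi)     _  = inj₂ refl
    bands-are-stars (inj₁ (gf _)) _  = inj₁ refl
    bands-are-stars (inj₂ (gf _)) ()
    bands-are-stars (inj₁ (df _)) ()
    bands-are-stars (inj₂ (df _)) _  = inj₂ refl

  H'-planar : ∀ k → Planar (H' k)
  H'-planar k = position , straight-line-drawing
    where open LevelledDrawing (H' k) x-coordinate level hub coordinates-injective adjacent-levels bands-are-stars

open import Data.Nat using (ℕ; _≤_; _∸_)
open import Data.Nat.Properties using (≤-trans; m≤m+n)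
open import Data.Integer using (ℤ; +_)
open import Data.Product as Prod using (_×_; _,_; ∃-syntax)
open import Data.Sum as Sum using (_⊎_; inj₁; inj₂)
open import Relation.Binary.PropositionalEquality using (_≡_; refl; cong)
open import Function using (_∘_)
open import Function.Bundles using (_⇔_; mk⇔)
open Labelling using (ExtremalPair; H'-labels-extremal; H'-has-extremal-labelling)
open Drawing using (H'-planar)

lemma6 : (k : ℕ) → 6 ≤ k →
    Planar (H' k) ×
    ((x y : ℤ) →
      (∃[ L ] (IsL21 k (H' k) L × + L c ≡ x × + L d ≡ y))
      ⇔
      ((x ≡ + 0 × y ≡ + k) ⊎ (x ≡ + 1 × y ≡ + k) ⊎
       (x ≡ + (k ∸ 1) × y ≡ + 0) ⊎ (x ≡ + k × y ≡ + 0)))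
lemma6 k 6≤k = H'-planar k , λ _ _ → mk⇔ necessary sufficient
  where
  Labelled Allowed : ℤ → ℤ → Set
  Labelled x y = ∃[ L ] (IsL21 k (H' k) L × + L c ≡ x × + L d ≡ y)
  Allowed x y  = (x ≡ + 0 × y ≡ + k) ⊎ (x ≡ + 1 × y ≡ + k) ⊎ (x ≡ + (k ∸ 1) × y ≡ + 0) ⊎ (x ≡ + k × y ≡ + 0)

  +-pair : ∀ {a b m n} → a ≡ m × b ≡ n → + a ≡ + m × + b ≡ + n
  +-pair = Prod.map (cong +_) (cong +_)

  necessary : ∀ {x y} → Labelled x y → Allowed x y
  necessary (L , isL , refl , refl) =
    Sum.map +-pair (Sum.map +-pair (Sum.map +-pair +-pair)) (H'-labels-extremal (≤-trans (m≤m+n 4 2) 6≤k) isL)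

  realise : ∀ {a b} → ExtremalPair k a b → Labelled (+ a) (+ b)
  realise = Prod.map₂ (Prod.map₂ +-pair) ∘ H'-has-extremal-labelling (≤-trans (m≤m+n 3 3) 6≤k)

  sufficient : ∀ {x y} → Allowed x y → Labelled x y
  sufficient (inj₁ (refl , refl))               = realise (inj₁ (refl , refl))
  sufficient (inj₂ (inj₁ (refl , refl)))        = realise (inj₂ (inj₁ (refl , refl)))
  sufficient (inj₂ (inj₂ (inj₁ (refl , refl)))) = realise (inj₂ (inj₂ (inj₁ (refl , refl))))
  sufficient (inj₂ (inj₂ (inj₂ (refl , refl)))) = realise (inj₂ (inj₂ (inj₂ (refl , refl))))
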